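{- For every integer $n \ge 3$, $R(Q_n,Q_n) \ge 2n+1$. That is, for every $n\ge 3$ there is a coloring of the elements of $Q_{2n}$ (the subsets of $[2n]$) with two colors such that no copy of $Q_n$ is monochromatic.
   Context: $Q_n$ denotes the poset of all subsets of $[n]=\{1,\dots,n\}$ ordered by inclusion. A poset embedding $f:2^{[n]}\to 2^{[m]}$ is an injective map with $S\subseteq T \iff f(S)\subseteq f(T)$ for all $S,T\subseteq[n]$; its image is called a copy of $Q_n$ (or of $2^{[n]}$) in $Q_m$. The cube Ramsey number $R(Q_n,Q_n)$ is the least integer $m$ such that every 2-coloring of the elements (vertices, i.e. subsets of $[m]$) of $Q_m$ admits a monochromatic copy of $Q_n$. -}

module Defs where

open import Data.Nat using (ℕ)
open import Data.Bool using (Bool)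
open import Data.Fin.Subset using (Subset; _⊆_)
open import Data.Product using (Σ; _×_; ∃)
open import Relation.Binary.PropositionalEquality using (_≡_)
open import Function.Bundles using (_⇔_)

-- Elements of Q_n: subsets of [n] = Fin n, as characteristic vectors.

record IsCubeEmbedding {n m : ℕ} (f : Subset n → Subset m) : Set where
  field
    injective : ∀ S T → f S ≡ f T → S ≡ T
    order     : ∀ S T → (S ⊆ T) ⇔ (f S ⊆ f T)

Coloring : ℕ → Set
Coloring m = Subset m → Bool

Monochromatic : {n m : ℕ} → Coloring m → (Subset n → Subset m) → Set
Monochromatic c f = ∃ λ b → ∀ S → c (f S) ≡ b

module Submission where

-- Pair [2n] as {i, n + i} and colour a subset S of [2n] red when 1 ≤ |S| < n or S = [2n], blue
-- when S = ∅ or n < |S| < 2n; a set with |S| = n is red when the number of pairs in which it holds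
-- only the lower element is even, except that the colour is flipped for the two halves of [2n].
--
-- Let f be a red copy of Q_n. Since f is strictly monotone and red sets other than [2n] have at
-- most n elements, |f S| = |S| + 1 for every S ≠ [n]: f ∅ = {x}, f {k} = {x, a_k} and
-- f ([n] - k) = {x} ∪ {a_l : l ≠ k}. Every facet C - c (c ≠ x) of the (n + 1)-set
-- C = f ([n] - 0) ∪ {a_0} is then some red f ([n] - k). But n + 1 elements in n pairs force a full
-- pair, and a case analysis on the pairs shows that at least two facets of every (n + 1)-set are
-- blue. Blue copies are excluded by the same argument for the dual colouring S ↦ ¬ colour ([2n] - S),
-- which has the same shape with the parity read off the upper elements.

open import Defs
open import Algebra.Lattice.Properties.BooleanAlgebra as BooleanAlgebraProperties using ()
open import Data.Bool as Bool using (Bool; true; false; not; _∧_; _∨_; _xor_)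
open import Data.Bool.Properties
  using (not-injective; not-¬; ∧-zeroʳ; ∨-zeroʳ; ∨-comm; not-distribˡ-xor; not-distribʳ-xor;
         xor-comm; xor-assoc; xor-annihilates-not; xor-same; xor-identityʳ; xor-inverseʳ)
open import Data.Empty using (⊥-elim) renaming (⊥ to Void)
open import Data.Fin as Fin using (Fin; zero; suc; _↑ˡ_; _↑ʳ_)
open import Data.Fin.Properties using (any?; ↑ˡ-injective; splitAt-↑ˡ; splitAt-↑ʳ)
open import Data.Fin.Subset using (Subset; inside; outside; _∈_; _∉_; _⊆_; _⊂_; ∣_∣; ⊥; ⊤; ⁅_⁆; ∁)
open import Data.Fin.Subset.Properties
  using (_∈?_; _⊆?_; ∉⊥; ⊥⊆; ∈⊤; ⊆⊤; x∈⁅x⁆; x∈⁅y⁆⇒x≡y; ∣⁅x⁆∣≡1; ∣⊥∣≡0; ∣⊤∣≡n; ∣p∣≤n; ∣p∣≡n⇒p≡⊤;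
         ∣∁p∣≡n∸∣p∣; ⊆-antisym; p⊆q⇒∣p∣≤∣q∣; p⊂q⇒∣p∣<∣q∣; p⊆q⇒∁p⊇∁q; ∁p⊆∁q⇒p⊇q;
         ∪-∩-booleanAlgebra)
open import Data.Nat using (ℕ; zero; suc; _+_; _*_; _∸_; _≤_; _<_; z≤n; s≤s; z<s; _<?_; _≟_)
open import Data.Nat.Properties
  using (≤-trans; ≤-reflexive; ≤-antisym; <-irrefl; <⇒≤; ≮⇒≥; ≤∧≢⇒<; n≤1+n; m≤n⇒m≤1+n; 1+n≰n;
         +-comm; +-suc; +-identityʳ; suc-injective; +-monoʳ-≤; +-cancelˡ-≤; m<n+m; m+1+n≢m;
         m∸n+n≡m; m+n∸m≡n; m<n⇒0<n∸m; m≤o∸n⇒m+n≤o; module ≤-Reasoning)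
open import Data.Product using (Σ; ∃; ∃₂; _×_; _,_; proj₁; proj₂)
open import Data.Product.Properties using (≡-dec)
open import Data.Sum using (_⊎_; inj₁; inj₂)
open import Data.Sum.Properties using (inj₂-injective)
open import Data.Vec using (Vec; []; _∷_; here; there; lookup; _[_]≔_; _++_; map; take; drop)
open import Data.Vec.Properties
  using (lookup⇒[]=; []≔-updates; []≔-minimal; lookup∘update; lookup∘update′; []≔-++-↑ˡ; []≔-++-↑ʳ;
         lookup-++ˡ; lookup-++ʳ; take++drop≡id; take-map; drop-map; ++-injectiveˡ; ++-injectiveʳ)
open import Function.Base using (_∘_)
open import Function.Bundles using (_⇔_; mk⇔; Equivalence)
open import Relation.Binary.Definitions using (DecidableEquality)
open import Relation.Binary.PropositionalEquality
  using (_≡_; _≢_; refl; sym; trans; cong; cong₂; subst; module ≡-Reasoning)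
open import Relation.Nullary using (¬_; Dec; yes; no; does)
open import Relation.Nullary.Decidable using (_×-dec_; ¬?; decidable-stable; dec-true; dec-false)

private
  variable
    k M N : ℕ

true≢false : true ≢ false
true≢false ()

remove : Subset N → Fin N → Subset N
remove p x = p [ x ]≔ outside

insert : Subset N → Fin N → Subset N
insert p x = p [ x ]≔ inside

∉-remove : ∀ (p : Subset N) x → x ∉ remove p x
∉-remove (_ ∷ p) zero    ()
∉-remove (_ ∷ p) (suc x) (there x∈) = ∉-remove p x x∈

remove-⊆ : ∀ (p : Subset N) x → remove p x ⊆ p
remove-⊆ (_ ∷ p) zero    (there y∈) = there y∈
remove-⊆ (_ ∷ p) (suc x) here       = here
remove-⊆ (_ ∷ p) (suc x) (there y∈) = there (remove-⊆ p x y∈)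

remove-⊂ : ∀ (p : Subset N) {x} → x ∈ p → remove p x ⊂ p
remove-⊂ p {x} x∈p = remove-⊆ p x , x , x∈p , ∉-remove p x

∈-remove⁺ : ∀ {p : Subset N} {x y} → y ∈ p → y ≢ x → y ∈ remove p x
∈-remove⁺ {p = p} {x} {y} y∈ y≢x = []≔-minimal p y x y≢x y∈

x∈insert : ∀ (p : Subset N) x → x ∈ insert p x
x∈insert p x = []≔-updates p x

insert-⊇ : ∀ (p : Subset N) x → p ⊆ insert p x
insert-⊇ (_ ∷ p) zero    here       = here
insert-⊇ (_ ∷ p) zero    (there y∈) = there y∈
insert-⊇ (_ ∷ p) (suc x) here       = here
insert-⊇ (_ ∷ p) (suc x) (there y∈) = there (insert-⊇ p x y∈)

∈-insert⁻ : ∀ (p : Subset N) x {y} → y ∈ insert p x → y ∈ p ⊎ y ≡ x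
∈-insert⁻ (_ ∷ p) zero    here       = inj₂ refl
∈-insert⁻ (_ ∷ p) zero    (there y∈) = inj₁ (there y∈)
∈-insert⁻ (_ ∷ p) (suc x) here       = inj₁ here
∈-insert⁻ (_ ∷ p) (suc x) (there y∈) with ∈-insert⁻ p x y∈
... | inj₁ y∈p = inj₁ (there y∈p)
... | inj₂ refl = inj₂ refl

∣remove∣ : ∀ (p : Subset N) {x} → x ∈ p → suc ∣ remove p x ∣ ≡ ∣ p ∣
∣remove∣ (_ ∷ p) here                      = refl
∣remove∣ (inside  ∷ p) {suc x} (there x∈) = cong suc (∣remove∣ p x∈)
∣remove∣ (outside ∷ p) {suc x} (there x∈) = ∣remove∣ p x∈

∣insert∣ : ∀ (p : Subset N) {x} → x ∉ p → ∣ insert p x ∣ ≡ suc ∣ p ∣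
∣insert∣ (inside  ∷ p) {zero}  x∉ = ⊥-elim (x∉ here)
∣insert∣ (outside ∷ p) {zero}  x∉ = refl
∣insert∣ (inside  ∷ p) {suc x} x∉ = cong suc (∣insert∣ p (λ x∈ → x∉ (there x∈)))
∣insert∣ (outside ∷ p) {suc x} x∉ = ∣insert∣ p (λ x∈ → x∉ (there x∈))

∃-∈ : ∀ {p : Subset N} → 0 < ∣ p ∣ → ∃ λ x → x ∈ p
∃-∈ {p = inside  ∷ p} _  = zero , here
∃-∈ {p = outside ∷ p} 0< = let x , x∈ = ∃-∈ 0< in suc x , there x∈

⊈⇒∃ : ∀ {p q : Subset N} → ¬ p ⊆ q → ∃ λ x → x ∈ p × x ∉ q
⊈⇒∃ {p = p} {q} p⊈q with any? (λ x → (x ∈? p) ×-dec ¬? (x ∈? q))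
... | yes witness = witness
... | no none     =
  ⊥-elim (p⊈q λ {x} x∈p → decidable-stable (x ∈? q) λ x∉q → none (x , x∈p , x∉q))

∣p∣<∣q∣⇒q⊈p : ∀ {p q : Subset N} → ∣ p ∣ < ∣ q ∣ → ¬ q ⊆ p
∣p∣<∣q∣⇒q⊈p ∣p∣<∣q∣ q⊆p = <-irrefl refl (≤-trans ∣p∣<∣q∣ (p⊆q⇒∣p∣≤∣q∣ q⊆p))

p⊆q∧∣q∣≤∣p∣⇒p≡q : ∀ {p q : Subset N} → p ⊆ q → ∣ q ∣ ≤ ∣ p ∣ → p ≡ q
p⊆q∧∣q∣≤∣p∣⇒p≡q {p = p} {q} p⊆q ∣q∣≤∣p∣ with q ⊆? p
... | yes q⊆p = ⊆-antisym p⊆q q⊆p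
... | no  q⊈p = ⊥-elim (<-irrefl refl (≤-trans (p⊂q⇒∣p∣<∣q∣ (p⊆q , ⊈⇒∃ q⊈p)) ∣q∣≤∣p∣))

∈-one-more : ∀ {p q : Subset N} {x y} → p ⊆ q → x ∈ q → x ∉ p → ∣ q ∣ ≡ suc ∣ p ∣ →
             y ∈ q → y ∈ p ⊎ y ≡ x
∈-one-more {p = p} {q} {x} {y} p⊆q x∈q x∉p ∣q∣≡ y∈q =
  ∈-insert⁻ p x (subst (y ∈_) (sym insert≡q) y∈q)
  where
  insert⊆q : insert p x ⊆ q
  insert⊆q z∈ with ∈-insert⁻ p x z∈
  ... | inj₁ z∈p = p⊆q z∈p
  ... | inj₂ refl = x∈q

  insert≡q : insert p x ≡ q
  insert≡q = p⊆q∧∣q∣≤∣p∣⇒p≡q insert⊆q (≤-reflexive (trans ∣q∣≡ (sym (∣insert∣ p x∉p))))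

⁅x⁆⊆ : ∀ {p : Subset N} {x} → x ∈ p → ⁅ x ⁆ ⊆ p
⁅x⁆⊆ {p = p} {x} x∈p y∈ = subst (_∈ p) (sym (x∈⁅y⁆⇒x≡y x y∈)) x∈p

OrderEmbedding : (Subset M → Subset N) → Set
OrderEmbedding f = ∀ S T → (S ⊆ T) ⇔ (f S ⊆ f T)

module Embedding {f : Subset M → Subset N} (emb : OrderEmbedding f) where

  mono : ∀ {S T} → S ⊆ T → f S ⊆ f T
  mono = Equivalence.to (emb _ _)

  reflect : ∀ {S T} → f S ⊆ f T → S ⊆ T
  reflect = Equivalence.from (emb _ _)

  strict : ∀ {S T} → S ⊂ T → f S ⊂ f T
  strict {S} {T} (S⊆T , x , x∈T , x∉S) =
    mono {S} {T} S⊆T , ⊈⇒∃ λ fT⊆fS → x∉S (reflect {T} {S} fT⊆fS x∈T)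

  growth : ∀ d {R S} → R ⊆ S → d + ∣ R ∣ ≡ ∣ S ∣ → d + ∣ f R ∣ ≤ ∣ f S ∣
  growth zero    R⊆S _  = p⊆q⇒∣p∣≤∣q∣ (mono R⊆S)
  growth (suc d) {R} {S} R⊆S eq with ⊈⇒∃ (∣p∣<∣q∣⇒q⊈p (subst (∣ R ∣ <_) eq (m<n+m ∣ R ∣ z<s)))
  ... | x , x∈S , x∉R = ≤-trans (s≤s (growth d R⊆S-x eq′)) (p⊂q⇒∣p∣<∣q∣ (strict (remove-⊂ S x∈S)))
    where
    R⊆S-x : R ⊆ remove S x
    R⊆S-x y∈R = ∈-remove⁺ (R⊆S y∈R) λ { refl → x∉R y∈R }
    eq′ : d + ∣ R ∣ ≡ ∣ remove S x ∣
    eq′ = suc-injective (trans eq (sym (∣remove∣ S x∈S)))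

  ≢⊤ : ∀ {S} → S ≢ ⊤ → f S ≢ ⊤
  ≢⊤ {S} S≢⊤ fS≡⊤ = S≢⊤ (⊆-antisym ⊆⊤ (reflect (subst (f ⊤ ⊆_) (sym fS≡⊤) ⊆⊤)))

∁-conjugate : ∀ {f : Subset M → Subset N} → OrderEmbedding f → OrderEmbedding (λ S → ∁ (f (∁ S)))
∁-conjugate {f = f} emb S T = mk⇔ to from
  where
  open Embedding emb
  to : S ⊆ T → ∁ (f (∁ S)) ⊆ ∁ (f (∁ T))
  to S⊆T = p⊆q⇒∁p⊇∁q (mono (p⊆q⇒∁p⊇∁q {p = S} S⊆T))
  from : ∁ (f (∁ S)) ⊆ ∁ (f (∁ T)) → S ⊆ T
  from ∁fS⊆∁fT = ∁p⊆∁q⇒p⊇q (reflect (∁p⊆∁q⇒p⊇q {p = f (∁ S)} ∁fS⊆∁fT))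

∁-involutive : ∀ (p : Subset N) → ∁ (∁ p) ≡ p
∁-involutive {N} = BooleanAlgebraProperties.¬-involutive (∪-∩-booleanAlgebra N)

-- A criterion excluding red cubes

record RedCriterion (n : ℕ) (red : Subset N → Bool) : Set where
  field
    red⇒nonempty : ∀ S → red S ≡ true → 0 < ∣ S ∣
    red⇒small    : ∀ S → red S ≡ true → S ≢ ⊤ → ∣ S ∣ ≤ n
    blue-facet   : ∀ C x → ∣ C ∣ ≡ suc n → ∃ λ c → c ∈ C × c ≢ x × red (remove C c) ≡ false

module NoRedCube {m} {red : Subset N → Bool} (criterion : RedCriterion (2 + m) red)
                 {f : Subset (2 + m) → Subset N} (emb : OrderEmbedding f)
                 (all-red : ∀ S → red (f S) ≡ true) where

  open RedCriterion criterion
  open Embedding emb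
  open ≤-Reasoning

  coatom : Fin (2 + m) → Subset (2 + m)
  coatom k = remove ⊤ k

  ∣coatom∣ : ∀ k → ∣ coatom k ∣ ≡ suc m
  ∣coatom∣ k = suc-injective (trans (∣remove∣ ⊤ {k} ∈⊤) (∣⊤∣≡n (2 + m)))

  ⊆coatom : ∀ {S k} → k ∉ S → S ⊆ coatom k
  ⊆coatom {S} k∉S y∈S = ∈-remove⁺ ∈⊤ λ { refl → k∉S y∈S }

  remove≢⊤ : ∀ (T : Subset (2 + m)) {k} → remove T k ≢ ⊤
  remove≢⊤ T {k} T-k≡⊤ = ∉-remove T k (subst (k ∈_) (sym T-k≡⊤) ∈⊤)

  coatom≢⊤ : ∀ k → coatom k ≢ ⊤
  coatom≢⊤ k = remove≢⊤ ⊤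

  small⇒≢⊤ : ∀ {S : Subset (2 + m)} → ∣ S ∣ < 2 + m → S ≢ ⊤
  small⇒≢⊤ ∣S∣<n refl = <-irrefl (∣⊤∣≡n (2 + m)) ∣S∣<n

  size-image-≥ : ∀ S → suc ∣ S ∣ ≤ ∣ f S ∣
  size-image-≥ S = begin
    suc ∣ S ∣        ≡⟨ +-comm 1 ∣ S ∣ ⟩
    ∣ S ∣ + 1        ≤⟨ +-monoʳ-≤ ∣ S ∣ (red⇒nonempty (f ⊥) (all-red ⊥)) ⟩
    ∣ S ∣ + ∣ f ⊥ ∣  ≤⟨ growth ∣ S ∣ ⊥⊆ (trans (cong (∣ S ∣ +_) (∣⊥∣≡0 (2 + m))) (+-identityʳ _)) ⟩
    ∣ f S ∣          ∎

  size-image-≤ : ∀ {S j} → j ∉ S → ∣ f S ∣ ≤ suc ∣ S ∣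
  size-image-≤ {S} {j} j∉S = +-cancelˡ-≤ d _ _ (begin
    d + ∣ f S ∣          ≤⟨ growth d (⊆coatom j∉S) (trans d+∣S∣ (sym (∣coatom∣ j))) ⟩
    ∣ f (coatom j) ∣     ≤⟨ red⇒small (f (coatom j)) (all-red (coatom j)) (≢⊤ (coatom≢⊤ j)) ⟩
    suc (suc m)          ≡⟨ cong suc (sym d+∣S∣) ⟩
    suc (d + ∣ S ∣)      ≡⟨ sym (+-suc d ∣ S ∣) ⟩
    d + suc ∣ S ∣        ∎)
    where
    d = suc m ∸ ∣ S ∣
    d+∣S∣ : d + ∣ S ∣ ≡ suc m
    d+∣S∣ = m∸n+n≡m (≤-trans (p⊆q⇒∣p∣≤∣q∣ (⊆coatom j∉S)) (≤-reflexive (∣coatom∣ j)))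

  -- f maps the chain from ⊥ to a coatom strictly increasingly into red sets, of sizes 1 … n.
  size-image : ∀ {S} → S ≢ ⊤ → ∣ f S ∣ ≡ suc ∣ S ∣
  size-image {S} S≢⊤ with ⊈⇒∃ (λ ⊤⊆S → S≢⊤ (⊆-antisym ⊆⊤ ⊤⊆S))
  ... | j , _ , j∉S = ≤-antisym (size-image-≤ j∉S) (size-image-≥ S)

  size-image-remove : ∀ {T k} → T ≢ ⊤ → k ∈ T → ∣ f T ∣ ≡ suc ∣ f (remove T k) ∣
  size-image-remove {T} T≢⊤ k∈T =
    trans (size-image T≢⊤) (cong suc (trans (sym (∣remove∣ T k∈T)) (sym (size-image (remove≢⊤ T)))))

  ∣f[coatom]∣ : ∀ k → ∣ f (coatom k) ∣ ≡ 2 + m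
  ∣f[coatom]∣ k = trans (size-image (coatom≢⊤ k)) (cong suc (∣coatom∣ k))

  new-point : ∀ {T : Subset (2 + m)} {k y} → T ≢ ⊤ → k ∈ T →
              y ∈ f T → y ∉ f (remove T k) → y ∈ f ⁅ k ⁆
  new-point {T} {k} T≢⊤ k∈T y∈fT y∉fT-k with ⊈⇒∃ (λ h → ∉-remove T k (reflect h (x∈⁅x⁆ k)))
  ... | z , z∈f⁅k⁆ , z∉fT-k
    with ∈-one-more (mono (remove-⊆ T k)) y∈fT y∉fT-k (size-image-remove T≢⊤ k∈T)
                    (mono (⁅x⁆⊆ k∈T) z∈f⁅k⁆)
  ... | inj₁ z∈fT-k = ⊥-elim (z∉fT-k z∈fT-k)
  ... | inj₂ refl   = z∈f⁅k⁆

  chain : ∀ d {T : Subset (2 + m)} → ∣ T ∣ ≡ d → T ≢ ⊤ → ∀ {y} → y ∈ f T → y ∉ f ⊥ →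
          ∃ λ k → k ∈ T × y ∈ f ⁅ k ⁆
  chain zero {T} ∣T∣≡0 _ y∈fT y∉f⊥ = ⊥-elim (y∉f⊥ (subst (λ R → _ ∈ f R) T≡⊥ y∈fT))
    where
    T≡⊥ : T ≡ ⊥
    T≡⊥ = sym (p⊆q∧∣q∣≤∣p∣⇒p≡q ⊥⊆ (≤-trans (≤-reflexive ∣T∣≡0) z≤n))
  chain (suc d) {T} ∣T∣≡ T≢⊤ {y} y∈fT y∉f⊥ with ∃-∈ (≤-trans (s≤s z≤n) (≤-reflexive (sym ∣T∣≡)))
  ... | k , k∈T with y ∈? f (remove T k)
  ...   | no  y∉fT-k = k , k∈T , new-point T≢⊤ k∈T y∈fT y∉fT-k
  ...   | yes y∈fT-k =
    let ∣T-k∣≡ = suc-injective (trans (∣remove∣ T k∈T) ∣T∣≡)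
        l , l∈T-k , y∈f⁅l⁆ = chain d ∣T-k∣≡ (remove≢⊤ T) y∈fT-k y∉f⊥
    in l , remove-⊆ T k l∈T-k , y∈f⁅l⁆

  ∣f⊥∣ : ∣ f ⊥ ∣ ≡ suc ∣ ⊥ {N} ∣
  ∣f⊥∣ = trans (size-image (small⇒≢⊤ (subst (_< 2 + m) (sym (∣⊥∣≡0 (2 + m))) z<s)))
               (cong suc (trans (∣⊥∣≡0 (2 + m)) (sym (∣⊥∣≡0 N))))

  ∣f⁅k⁆∣ : ∀ k → ∣ f ⁅ k ⁆ ∣ ≡ suc ∣ f ⊥ ∣
  ∣f⁅k⁆∣ k = trans (size-image (small⇒≢⊤ (subst (_< 2 + m) (sym (∣⁅x⁆∣≡1 k)) (s≤s (s≤s z≤n)))))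
                   (cong suc (trans (∣⁅x⁆∣≡1 k) (sym (trans ∣f⊥∣ (cong suc (∣⊥∣≡0 N))))))

  f⊥-point : ∀ {x y} → x ∈ f ⊥ → y ∈ f ⊥ → y ≡ x
  f⊥-point x∈ y∈ with ∈-one-more ⊥⊆ x∈ ∉⊥ ∣f⊥∣ y∈
  ... | inj₁ y∈⊥ = ⊥-elim (∉⊥ y∈⊥)
  ... | inj₂ y≡x = y≡x

  f⁅k⁆-point : ∀ {k a y} → a ∈ f ⁅ k ⁆ → a ∉ f ⊥ → y ∈ f ⁅ k ⁆ → y ∈ f ⊥ ⊎ y ≡ a
  f⁅k⁆-point {k} a∈ a∉ = ∈-one-more (mono ⊥⊆) a∈ a∉ (∣f⁅k⁆∣ k)

  new-point∉coatom : ∀ {k a} → a ∈ f ⁅ k ⁆ → a ∉ f ⊥ → a ∉ f (coatom k)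
  new-point∉coatom {k} {a} a∈ a∉ a∈f[coatom] = ∉-remove ⊤ k (reflect f⁅k⁆⊆ (x∈⁅x⁆ k))
    where
    f⁅k⁆⊆ : f ⁅ k ⁆ ⊆ f (coatom k)
    f⁅k⁆⊆ y∈ with f⁅k⁆-point a∈ a∉ y∈
    ... | inj₁ y∈f⊥ = mono ⊥⊆ y∈f⊥
    ... | inj₂ refl = a∈f[coatom]

  -- C is f (coatom 0) plus the new point a of f ⁅ 0 ⁆; each facet of C missing a point
  -- other than the one of f ⊥ is one of the red sets f (coatom k).
  module _ {x a} (x∈f⊥ : x ∈ f ⊥) (a∈ : a ∈ f ⁅ zero ⁆) (a∉ : a ∉ f (coatom zero)) where

    a∉f⊥ : a ∉ f ⊥
    a∉f⊥ a∈f⊥ = a∉ (mono ⊥⊆ a∈f⊥)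

    C : Subset N
    C = insert (f (coatom zero)) a

    ∣C∣ : ∣ C ∣ ≡ suc (2 + m)
    ∣C∣ = trans (∣insert∣ _ a∉) (cong suc (∣f[coatom]∣ zero))

    f[coatom]⊆C : ∀ k → f (coatom k) ⊆ C
    f[coatom]⊆C k {y} y∈ with y ∈? f ⊥
    ... | yes y∈f⊥ = insert-⊇ _ a (mono ⊥⊆ y∈f⊥)
    ... | no  y∉f⊥ with chain (suc m) (∣coatom∣ k) (coatom≢⊤ k) y∈ y∉f⊥
    ...   | l , _ , y∈f⁅l⁆ with l Fin.≟ zero
    ...     | no l≢0 = insert-⊇ _ a (mono (⊆coatom λ 0∈⁅l⁆ → l≢0 (sym (x∈⁅y⁆⇒x≡y l 0∈⁅l⁆))) y∈f⁅l⁆)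
    ...     | yes refl with f⁅k⁆-point {zero} a∈ a∉f⊥ y∈f⁅l⁆
    ...       | inj₁ y∈f⊥ = ⊥-elim (y∉f⊥ y∈f⊥)
    ...       | inj₂ refl = x∈insert _ a

    facet-is-image : ∀ {c k} → c ∈ C → c ∈ f ⁅ k ⁆ → c ∉ f ⊥ → f (coatom k) ≡ remove C c
    facet-is-image {c} {k} c∈C c∈ c∉ = p⊆q∧∣q∣≤∣p∣⇒p≡q f[coatom]⊆C-c (≤-reflexive ∣C-c∣≡)
      where
      f[coatom]⊆C-c : f (coatom k) ⊆ remove C c
      f[coatom]⊆C-c y∈ = ∈-remove⁺ (f[coatom]⊆C k y∈) λ { refl → new-point∉coatom c∈ c∉ y∈ }
      ∣C-c∣≡ : ∣ remove C c ∣ ≡ ∣ f (coatom k) ∣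
      ∣C-c∣≡ = suc-injective (trans (∣remove∣ C c∈C) (trans ∣C∣ (cong suc (sym (∣f[coatom]∣ k)))))

    source : ∀ {c} → c ∈ C → c ∉ f ⊥ → ∃ λ k → c ∈ f ⁅ k ⁆
    source c∈C c∉ with ∈-insert⁻ _ a c∈C
    ... | inj₂ refl        = zero , a∈
    ... | inj₁ c∈f[coatom] =
      let k , _ , c∈f⁅k⁆ = chain (suc m) (∣coatom∣ zero) (coatom≢⊤ zero) c∈f[coatom] c∉ in k , c∈f⁅k⁆

    contradiction : Void
    contradiction =
      let c , c∈C , c≢x , blue = blue-facet C x ∣C∣
          c∉f⊥ = λ c∈f⊥ → c≢x (f⊥-point x∈f⊥ c∈f⊥)
          k , c∈f⁅k⁆ = source c∈C c∉f⊥
      in true≢false (trans (sym (all-red (coatom k)))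
                           (trans (cong red (facet-is-image c∈C c∈f⁅k⁆ c∉f⊥)) blue))

no-red-cube : ∀ {m} {red : Subset N → Bool} → RedCriterion (2 + m) red →
              ∀ {f : Subset (2 + m) → Subset N} → OrderEmbedding f → ¬ (∀ S → red (f S) ≡ true)
no-red-cube criterion {f} emb all-red
  with ∃-∈ (RedCriterion.red⇒nonempty criterion (f ⊥) (all-red ⊥))
     | ⊈⇒∃ (λ f⁅0⁆⊆f[coatom] → ∉-remove ⊤ zero (Embedding.reflect emb f⁅0⁆⊆f[coatom] (x∈⁅x⁆ zero)))
... | _ , x∈f⊥ | _ , a∈ , a∉ = NoRedCube.contradiction criterion emb all-red x∈f⊥ a∈ a∉

-- A pair records which of its two elements are present; the side false is the lower element.
Pair : Set
Pair = Bool × Bool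

full empty : Pair
full  = true , true
empty = false , false

single : Bool → Pair
single false = true , false
single true  = false , true

_≟ᴾ_ : DecidableEquality Pair
_≟ᴾ_ = ≡-dec Bool._≟_ Bool._≟_

get : Bool → Pair → Bool
get false = proj₁
get true  = proj₂

clear : Bool → Pair → Pair
clear false (_ , b) = false , b
clear true  (a , _) = a , false

Position : ℕ → Set
Position k = Fin k × Bool

_∈ᴾ_ : Position k → Vec Pair k → Set
(i , s) ∈ᴾ P = get s (lookup P i) ≡ true

erase : Vec Pair k → Position k → Vec Pair k
erase P (i , s) = P [ i ]≔ clear s (lookup P i)

size : Pair → ℕ
size (true  , true)  = 2
size (true  , false) = 1
size (false , true)  = 1
size (false , false) = 0

weight : Vec Pair k → ℕ
weight []      = 0
weight (p ∷ P) = size p + weight P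

isSingle : Bool → Pair → Bool
isSingle t p = does (p ≟ᴾ single t)

singlesParity : Bool → Vec Pair k → Bool
singlesParity t []      = false
singlesParity t (p ∷ P) = isSingle t p xor singlesParity t P

allSingle : Bool → Vec Pair k → Bool
allSingle t []      = true
allSingle t (p ∷ P) = isSingle t p ∧ allSingle t P

exceptional : Vec Pair k → Bool
exceptional P = allSingle false P ∨ allSingle true P

-- The parity of the pairs holding only their side-t element, shifted by β and flipped on the two
-- exceptional vectors. The colouring uses middle false true; its dual is middle true false.
middle : Bool → Bool → Vec Pair k → Bool
middle t β P = (singlesParity t P xor β) xor exceptional P

get-full : ∀ s → get s full ≡ true
get-full false = refl
get-full true  = refl

get-single : ∀ s → get s (single s) ≡ true
get-single false = refl
get-single true  = refl

clear-full : ∀ s → clear s full ≡ single (not s)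
clear-full false = refl
clear-full true  = refl

clear-full-not : ∀ s → clear (not s) full ≡ single s
clear-full-not false = refl
clear-full-not true  = refl

clear-single : ∀ s → clear s (single s) ≡ empty
clear-single false = refl
clear-single true  = refl

isSingle-full : ∀ t → isSingle t full ≡ false
isSingle-full false = refl
isSingle-full true  = refl

isSingle-empty : ∀ t → isSingle t empty ≡ false
isSingle-empty false = refl
isSingle-empty true  = refl

isSingle-not : ∀ t s → isSingle t (single (not s)) ≡ not (isSingle t (single s))
isSingle-not false false = refl
isSingle-not false true  = refl
isSingle-not true  false = refl
isSingle-not true  true  = refl

single-for-parity : ∀ t π → ∃ λ s → isSingle t (single s) ≡ π
single-for-parity false false = true  , refl
single-for-parity false true  = false , refl
single-for-parity true  false = false , refl
single-for-parity true  true  = true  , refl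

full≢single : ∀ s → full ≢ single s
full≢single false ()
full≢single true  ()

empty≢single : ∀ s → empty ≢ single s
empty≢single false ()
empty≢single true  ()

single≢single-not : ∀ s → single s ≢ single (not s)
single≢single-not false ()
single≢single-not true  ()

single-dichotomy : ∀ {p} s → (∃ λ s′ → p ≡ single s′) → p ≡ single s ⊎ p ≡ single (not s)
single-dichotomy false (false , refl) = inj₁ refl
single-dichotomy false (true  , refl) = inj₂ refl
single-dichotomy true  (false , refl) = inj₂ refl
single-dichotomy true  (true  , refl) = inj₁ refl

xor-replace : ∀ a b r → b xor r ≡ (a xor r) xor (a xor b)
xor-replace false b r = xor-comm b r
xor-replace true  b r = trans (xor-comm b r) (sym (xor-annihilates-not r b))

xor-swapʳ : ∀ a b c → (a xor b) xor c ≡ (a xor c) xor b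
xor-swapʳ a b c =
  trans (xor-assoc a b c) (trans (cong (a xor_) (xor-comm b c)) (sym (xor-assoc a c b)))

singlesParity-update : ∀ t (P : Vec Pair k) i v →
  singlesParity t (P [ i ]≔ v) ≡ singlesParity t P xor (isSingle t (lookup P i) xor isSingle t v)
singlesParity-update t (p ∷ P) zero    v = xor-replace (isSingle t p) (isSingle t v) (singlesParity t P)
singlesParity-update t (p ∷ P) (suc i) v =
  trans (cong (isSingle t p xor_) (singlesParity-update t P i v))
        (sym (xor-assoc (isSingle t p) (singlesParity t P) _))

allSingle-false : ∀ t (P : Vec Pair k) j → lookup P j ≢ single t → allSingle t P ≡ false
allSingle-false t (p ∷ P) zero    p≢ rewrite dec-false (p ≟ᴾ single t) p≢ = refl
allSingle-false t (p ∷ P) (suc j) h  rewrite allSingle-false t P j h = ∧-zeroʳ _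

allSingle-true : ∀ t (P : Vec Pair k) → (∀ j → lookup P j ≡ single t) → allSingle t P ≡ true
allSingle-true t []      _ = refl
allSingle-true t (p ∷ P) h rewrite dec-true (p ≟ᴾ single t) (h zero) =
  allSingle-true t P (λ j → h (suc j))

exceptional-false : ∀ s (P : Vec Pair k) {i j} → lookup P i ≢ single s → lookup P j ≢ single (not s) →
                    exceptional P ≡ false
exceptional-false false P {i} {j} hi hj
  rewrite allSingle-false false P i hi | allSingle-false true P j hj = refl
exceptional-false true  P {i} {j} hi hj
  rewrite allSingle-false false P j hj | allSingle-false true P i hi = refl

exceptional-true : ∀ s (P : Vec Pair k) → (∀ j → lookup P j ≡ single s) → exceptional P ≡ true
exceptional-true false P h rewrite allSingle-true false P h = refl
exceptional-true true  P h rewrite allSingle-true true  P h = ∨-zeroʳ _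

full-exists : ∀ (P : Vec Pair k) → k < weight P → ∃ λ i → lookup P i ≡ full
full-exists ((true  , true)  ∷ P) _       = zero , refl
full-exists ((true  , false) ∷ P) (s≤s h) = let i , Pi = full-exists P h in suc i , Pi
full-exists ((false , true)  ∷ P) (s≤s h) = let i , Pi = full-exists P h in suc i , Pi
full-exists ((false , false) ∷ P) h       =
  let i , Pi = full-exists P (≤-trans (n≤1+n _) h) in suc i , Pi

weight≤length : ∀ (P : Vec Pair k) → (∀ j → lookup P j ≢ full) → weight P ≤ k
weight≤length []                    _  = z≤n
weight≤length ((true  , true)  ∷ P) nf = ⊥-elim (nf zero refl)
weight≤length ((true  , false) ∷ P) nf = s≤s (weight≤length P (λ j → nf (suc j)))
weight≤length ((false , true)  ∷ P) nf = s≤s (weight≤length P (λ j → nf (suc j)))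
weight≤length ((false , false) ∷ P) nf = m≤n⇒m≤1+n (weight≤length P (λ j → nf (suc j)))

all-single : ∀ (P : Vec Pair k) → (∀ j → lookup P j ≢ full) → weight P ≡ k →
             ∀ j → ∃ λ s → lookup P j ≡ single s
all-single ((true  , true)  ∷ P) nf _ _       = ⊥-elim (nf zero refl)
all-single ((true  , false) ∷ P) _  _ zero    = false , refl
all-single ((false , true)  ∷ P) _  _ zero    = true  , refl
all-single ((true  , false) ∷ P) nf w (suc j) = all-single P (λ j → nf (suc j)) (suc-injective w) j
all-single ((false , true)  ∷ P) nf w (suc j) = all-single P (λ j → nf (suc j)) (suc-injective w) j
all-single ((false , false) ∷ P) nf w _       =
  ⊥-elim (1+n≰n (≤-trans (≤-reflexive (sym w)) (weight≤length P (λ j → nf (suc j)))))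

weight-split-full : ∀ (P : Vec Pair k) {i} → lookup P i ≡ full →
                    suc (weight (P [ i ]≔ single false)) ≡ weight P
weight-split-full (p ∷ P) {zero}  refl = refl
weight-split-full (p ∷ P) {suc i} Pi   =
  trans (sym (+-suc (size p) _)) (cong (size p +_) (weight-split-full P Pi))

-- Blanking one element of the only full pair leaves a vector of weight = length without full pairs.
others-single : ∀ (P : Vec Pair k) {i} → lookup P i ≡ full → weight P ≡ suc k →
                (∀ j → j ≢ i → lookup P j ≢ full) → ∀ j → j ≢ i → ∃ λ s → lookup P j ≡ single s
others-single {k} P {i} Pi w unique j j≢i =
  subst (λ p → ∃ λ s → p ≡ single s) (lookup∘update′ j≢i P (single false))
        (all-single Q Q-no-full (suc-injective (trans (weight-split-full P Pi) w)) j)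
  where
  Q = P [ i ]≔ single false
  Q-no-full : ∀ j → lookup Q j ≢ full
  Q-no-full j Qj≡full with j Fin.≟ i
  ... | yes refl = full≢single false (trans (sym Qj≡full) (lookup∘update j P (single false)))
  ... | no  j≢i  = unique j j≢i (trans (sym (lookup∘update′ j≢i P (single false))) Qj≡full)

search : ∀ (P : Vec Pair k) i v → Dec (∃ λ j → j ≢ i × lookup P j ≡ v)
search P i v = any? λ j → ¬? (j Fin.≟ i) ×-dec (lookup P j ≟ᴾ v)

avoid-two : ∀ {m} (i j : Fin (3 + m)) → ∃ λ l → l ≢ i × l ≢ j
avoid-two zero                zero          = suc zero , (λ ()) , (λ ())
avoid-two zero                (suc zero)    = suc (suc zero) , (λ ()) , (λ ())
avoid-two zero                (suc (suc _)) = suc zero , (λ ()) , (λ ())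
avoid-two (suc zero)          zero          = suc (suc zero) , (λ ()) , (λ ())
avoid-two (suc zero)          (suc _)       = zero , (λ ()) , (λ ())
avoid-two (suc (suc _))       zero          = suc zero , (λ ()) , (λ ())
avoid-two (suc (suc _))       (suc _)       = zero , (λ ()) , (λ ())

Good : Bool → Bool → Vec Pair k → Position k → Set
Good t β P q = q ∈ᴾ P × middle t β (erase P q) ≡ false

TwoGood : Bool → Bool → Vec Pair k → Set
TwoGood t β P = ∃₂ λ q q′ → q ≢ q′ × Good t β P q × Good t β P q′

module Removal (t β : Bool) (P : Vec Pair k) (s : Bool)
               (s-good : isSingle t (single s) ≡ singlesParity t P xor β) where

  π : Bool
  π = singlesParity t P xor β

  parity-after : ∀ {i u} v → lookup P i ≡ u →
                 singlesParity t (P [ i ]≔ v) xor β ≡ π xor (isSingle t u xor isSingle t v)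
  parity-after {i} v refl =
    trans (cong (_xor β) (singlesParity-update t P i v)) (xor-swapʳ (singlesParity t P) _ β)

  erased-good : ∀ {i s′ u v} → lookup P i ≡ u → clear s′ u ≡ v → get s′ u ≡ true →
                π xor (isSingle t u xor isSingle t v) ≡ exceptional (P [ i ]≔ v) → Good t β P (i , s′)
  erased-good {i} {s′} {u} {v} Pi cleared present parity≡exc =
    trans (cong (get s′) Pi) present , (begin
      middle t β (erase P (i , s′))  ≡⟨ cong (λ w → middle t β (P [ i ]≔ w)) erased ⟩
      middle t β (P [ i ]≔ v)        ≡⟨ cong (_xor E) (trans (parity-after v Pi) parity≡exc) ⟩
      E xor E                        ≡⟨ xor-same E ⟩
      false                          ∎)
    where
    open ≡-Reasoning
    E = exceptional (P [ i ]≔ v)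
    erased = trans (cong (clear s′) Pi) cleared

  at-updated : ∀ {i v w} → v ≢ w → lookup (P [ i ]≔ v) i ≢ w
  at-updated {i} {v} v≢w e = v≢w (trans (sym (lookup∘update i P v)) e)

  away-from-updated : ∀ {i j v w} → j ≢ i → lookup P j ≢ w → lookup (P [ i ]≔ v) j ≢ w
  away-from-updated {v = v} j≢i Pj≢w e = Pj≢w (trans (sym (lookup∘update′ j≢i P v)) e)

  good-single : ∀ {i} → lookup P i ≡ single s → Good t β P (i , s)
  good-single {i} Pi = erased-good Pi (clear-single s) (get-single s) (begin
    π xor (isSingle t (single s) xor isSingle t empty)
      ≡⟨ cong₂ (λ a b → π xor (a xor b)) s-good (isSingle-empty t) ⟩
    π xor (π xor false)  ≡⟨ cong (π xor_) (xor-identityʳ π) ⟩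
    π xor π              ≡⟨ xor-same π ⟩
    false
      ≡⟨ sym (exceptional-false s (P [ i ]≔ empty) (at-updated (empty≢single s))
                                                   (at-updated (empty≢single (not s)))) ⟩
    exceptional (P [ i ]≔ empty) ∎)
    where open ≡-Reasoning

  good-full-keep : ∀ {i j} → lookup P i ≡ full → j ≢ i → lookup P j ≢ single s →
                   Good t β P (i , not s)
  good-full-keep {i} {j} Pi j≢i Pj≢ = erased-good Pi (clear-full-not s) (get-full (not s)) (begin
    π xor (isSingle t full xor isSingle t (single s))
      ≡⟨ cong₂ (λ a b → π xor (a xor b)) (isSingle-full t) s-good ⟩
    π xor π  ≡⟨ xor-same π ⟩
    false
      ≡⟨ sym (exceptional-false s (P [ i ]≔ single s) (away-from-updated j≢i Pj≢)
                                                      (at-updated (single≢single-not s))) ⟩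
    exceptional (P [ i ]≔ single s) ∎)
    where open ≡-Reasoning

  good-full-exceptional : ∀ {i} → lookup P i ≡ full → (∀ j → j ≢ i → lookup P j ≡ single (not s)) →
                          Good t β P (i , s)
  good-full-exceptional {i} Pi others = erased-good Pi (clear-full s) (get-full s) (begin
    π xor (isSingle t full xor isSingle t (single (not s)))
      ≡⟨ cong₂ (λ a b → π xor (a xor b)) (isSingle-full t) (trans (isSingle-not t s) (cong not s-good)) ⟩
    π xor not π  ≡⟨ xor-inverseʳ π ⟩
    true         ≡⟨ sym (exceptional-true (not s) (P [ i ]≔ single (not s)) all-single-not-s) ⟩
    exceptional (P [ i ]≔ single (not s)) ∎)
    where
    open ≡-Reasoning
    all-single-not-s : ∀ j → lookup (P [ i ]≔ single (not s)) j ≡ single (not s)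
    all-single-not-s j with j Fin.≟ i
    ... | yes refl = lookup∘update j P (single (not s))
    ... | no  j≢i  = trans (lookup∘update′ j≢i P (single (not s))) (others j j≢i)

distinct-positions : ∀ {i j : Fin k} {a b : Bool} → i ≢ j → (i , a) ≢ (j , b)
distinct-positions i≢j e = i≢j (cong proj₁ e)

module TwoGoodCases (t β : Bool) {m} (P : Vec Pair (3 + m)) (s : Bool)
                    (s-good : isSingle t (single s) ≡ singlesParity t P xor β) where

  open Removal t β P s s-good

  two-good-unique-full : ∀ {i} → lookup P i ≡ full → (∀ j → j ≢ i → ∃ λ s′ → lookup P j ≡ single s′) →
                         TwoGood t β P
  two-good-unique-full {i} Pi singles with search P i (single s)
  ... | no no-s =
    (i , not s) , (i , s) , (λ e → not-¬ refl (sym (cong proj₂ e))) ,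
    good-full-keep Pi l≢i (λ Pl → no-s (l , l≢i , Pl)) , good-full-exceptional Pi others
    where
    l = proj₁ (avoid-two i i)
    l≢i = proj₁ (proj₂ (avoid-two i i))
    others : ∀ j → j ≢ i → lookup P j ≡ single (not s)
    others j j≢i with single-dichotomy s (singles j j≢i)
    ... | inj₁ Pj = ⊥-elim (no-s (j , j≢i , Pj))
    ... | inj₂ Pj = Pj
  ... | yes (h , h≢i , Ph) with search P i (single (not s))
  ...   | yes (l , l≢i , Pl) =
    (h , s) , (i , not s) , distinct-positions h≢i ,
    good-single Ph , good-full-keep Pi l≢i (λ Pl′ → single≢single-not s (trans (sym Pl′) Pl))
  ...   | no no-not-s =
    (h , s) , (l , s) , distinct-positions (λ h≡l → l≢h (sym h≡l)) , good-single Ph , good-single Pl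
    where
    l = proj₁ (avoid-two i h)
    l≢i = proj₁ (proj₂ (avoid-two i h))
    l≢h = proj₂ (proj₂ (avoid-two i h))
    Pl : lookup P l ≡ single s
    Pl with single-dichotomy s (singles l l≢i)
    ... | inj₁ Pl = Pl
    ... | inj₂ Pl = ⊥-elim (no-not-s (l , l≢i , Pl))

-- The weight forces a full pair; which elements may be erased is governed by the side s whose
-- single pairs have the parity singlesParity t P xor β.
two-good : ∀ t β {m} (P : Vec Pair (3 + m)) → weight P ≡ 4 + m → TwoGood t β P
two-good t β P w with single-for-parity t (singlesParity t P xor β) | full-exists P (≤-reflexive (sym w))
... | s , s-good | i , Pi with search P i full
...   | yes (j , j≢i , Pj) =
  (i , not s) , (j , not s) , distinct-positions (λ i≡j → j≢i (sym i≡j)) ,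
  good-full-keep Pi j≢i (full≢single s ∘ trans (sym Pj)) ,
  good-full-keep Pj (λ i≡j → j≢i (sym i≡j)) (full≢single s ∘ trans (sym Pi))
  where open Removal t β P s s-good
...   | no unique =
  TwoGoodCases.two-good-unique-full t β P s s-good Pi
    (others-single P Pi w λ j j≢i Pj → unique (j , j≢i , Pj))

complement : Pair → Pair
complement (a , b) = not a , not b

isSingle-complement : ∀ t p → isSingle t (complement p) ≡ isSingle (not t) p
isSingle-complement false (true  , true)  = refl
isSingle-complement false (true  , false) = refl
isSingle-complement false (false , true)  = refl
isSingle-complement false (false , false) = refl
isSingle-complement true  (true  , true)  = refl
isSingle-complement true  (true  , false) = refl
isSingle-complement true  (false , true)  = refl
isSingle-complement true  (false , false) = refl

singlesParity-complement : ∀ t (P : Vec Pair k) →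
                           singlesParity t (map complement P) ≡ singlesParity (not t) P
singlesParity-complement t []      = refl
singlesParity-complement t (p ∷ P) = cong₂ _xor_ (isSingle-complement t p) (singlesParity-complement t P)

allSingle-complement : ∀ t (P : Vec Pair k) → allSingle t (map complement P) ≡ allSingle (not t) P
allSingle-complement t []      = refl
allSingle-complement t (p ∷ P) = cong₂ _∧_ (isSingle-complement t p) (allSingle-complement t P)

exceptional-complement : ∀ (P : Vec Pair k) → exceptional (map complement P) ≡ exceptional P
exceptional-complement P =
  trans (cong₂ _∨_ (allSingle-complement false P) (allSingle-complement true P))
        (∨-comm (allSingle true P) (allSingle false P))

middle-complement : ∀ t β (P : Vec Pair k) → middle t β (map complement P) ≡ middle (not t) β P
middle-complement t β P =
  cong₂ (λ a e → (a xor β) xor e) (singlesParity-complement t P) (exceptional-complement P)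

middle-not : ∀ t β (P : Vec Pair k) → middle t (not β) P ≡ not (middle t β P)
middle-not t β P = trans (cong (_xor exceptional P) (sym (not-distribʳ-xor (singlesParity t P) β)))
                         (sym (not-distribˡ-xor (singlesParity t P xor β) (exceptional P)))

-- Subsets of [2n] as vectors of pairs

zipHalves : Vec Bool k → Vec Bool (k + 0) → Vec Pair k
zipHalves []      []      = []
zipHalves (a ∷ L) (b ∷ R) = (a , b) ∷ zipHalves L R

lookup-zipHalves : ∀ (L : Vec Bool k) R i → lookup (zipHalves L R) i ≡ (lookup L i , lookup R (i ↑ˡ 0))
lookup-zipHalves (a ∷ L) (b ∷ R) zero    = refl
lookup-zipHalves (a ∷ L) (b ∷ R) (suc i) = lookup-zipHalves L R i

zipHalves-updateˡ : ∀ (L : Vec Bool k) R i b →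
                    zipHalves (L [ i ]≔ b) R ≡ zipHalves L R [ i ]≔ (b , lookup R (i ↑ˡ 0))
zipHalves-updateˡ (a ∷ L) (c ∷ R) zero    b = refl
zipHalves-updateˡ (a ∷ L) (c ∷ R) (suc i) b = cong ((a , c) ∷_) (zipHalves-updateˡ L R i b)

zipHalves-updateʳ : ∀ (L : Vec Bool k) R i b →
                    zipHalves L (R [ i ↑ˡ 0 ]≔ b) ≡ zipHalves L R [ i ]≔ (lookup L i , b)
zipHalves-updateʳ (a ∷ L) (c ∷ R) zero    b = refl
zipHalves-updateʳ (a ∷ L) (c ∷ R) (suc i) b = cong ((a , c) ∷_) (zipHalves-updateʳ L R i b)

weight-zipHalves : ∀ (L : Vec Bool k) R → weight (zipHalves L R) ≡ ∣ L ∣ + ∣ R ∣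
weight-zipHalves []          []          = refl
weight-zipHalves (true  ∷ L) (true  ∷ R) =
  cong suc (trans (cong suc (weight-zipHalves L R)) (sym (+-suc _ _)))
weight-zipHalves (true  ∷ L) (false ∷ R) = cong suc (weight-zipHalves L R)
weight-zipHalves (false ∷ L) (true  ∷ R) = trans (cong suc (weight-zipHalves L R)) (sym (+-suc _ _))
weight-zipHalves (false ∷ L) (false ∷ R) = weight-zipHalves L R

zipHalves-∁ : ∀ (L : Vec Bool k) R → zipHalves (∁ L) (∁ R) ≡ map complement (zipHalves L R)
zipHalves-∁ []      []      = refl
zipHalves-∁ (a ∷ L) (b ∷ R) = cong ((not a , not b) ∷_) (zipHalves-∁ L R)

∣++∣ : ∀ {k l} (L : Subset k) (R : Subset l) → ∣ L ++ R ∣ ≡ ∣ L ∣ + ∣ R ∣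
∣++∣ []          R = refl
∣++∣ (true  ∷ L) R = cong suc (∣++∣ L R)
∣++∣ (false ∷ L) R = ∣++∣ L R

-- The pairs of [2n] are {i, n + i}; the first component of a pair records i.
pairs : ∀ n → Subset (2 * n) → Vec Pair n
pairs n S = zipHalves (take n S) (drop n S)

element : ∀ n → Position n → Fin (2 * n)
element n (i , false) = i ↑ˡ (n + 0)
element n (i , true)  = n ↑ʳ (i ↑ˡ 0)

module _ (n : ℕ) where

  open ≡-Reasoning

  by-halves : (Φ : Subset (2 * n) → Set) → (∀ L R → Φ (L ++ R)) → ∀ S → Φ S
  by-halves Φ Φ-++ S = subst Φ (take++drop≡id n S) (Φ-++ (take n S) (drop n S))

  pairs-++ : ∀ L R → pairs n (L ++ R) ≡ zipHalves L R
  pairs-++ L R =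
    cong₂ zipHalves (++-injectiveˡ (take n (L ++ R)) L halves) (++-injectiveʳ (take n (L ++ R)) L halves)
    where
    halves = take++drop≡id n (L ++ R)

  lookup-pairs-++ : ∀ L R i → lookup (pairs n (L ++ R)) i ≡ (lookup L i , lookup R (i ↑ˡ 0))
  lookup-pairs-++ L R i = trans (cong (λ P → lookup P i) (pairs-++ L R)) (lookup-zipHalves L R i)

  lookup-element : ∀ S (q : Position n) →
                   lookup S (element n q) ≡ get (proj₂ q) (lookup (pairs n S) (proj₁ q))
  lookup-element = by-halves _ λ where
    L R (i , false) → trans (lookup-++ˡ L R i) (sym (cong proj₁ (lookup-pairs-++ L R i)))
    L R (i , true)  → trans (lookup-++ʳ L R (i ↑ˡ 0)) (sym (cong proj₂ (lookup-pairs-++ L R i)))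

  element-∈ : ∀ {S} {q : Position n} → q ∈ᴾ pairs n S → element n q ∈ S
  element-∈ {S} {q} q∈ = lookup⇒[]= (element n q) S (trans (lookup-element S q) q∈)

  pairs-remove : ∀ S (q : Position n) → pairs n (remove S (element n q)) ≡ erase (pairs n S) q
  pairs-remove = by-halves _ λ where
    L R (i , false) → begin
      pairs n ((L ++ R) [ i ↑ˡ (n + 0) ]≔ false)  ≡⟨ cong (pairs n) ([]≔-++-↑ˡ L R i) ⟩
      pairs n ((L [ i ]≔ false) ++ R)            ≡⟨ pairs-++ (L [ i ]≔ false) R ⟩
      zipHalves (L [ i ]≔ false) R               ≡⟨ zipHalves-updateˡ L R i false ⟩
      zipHalves L R [ i ]≔ (false , lookup R (i ↑ˡ 0))
        ≡⟨ cong₂ (λ P p → P [ i ]≔ clear false p) (sym (pairs-++ L R)) (sym (lookup-pairs-++ L R i)) ⟩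
      erase (pairs n (L ++ R)) (i , false)       ∎
    L R (i , true) → begin
      pairs n ((L ++ R) [ n ↑ʳ (i ↑ˡ 0) ]≔ false) ≡⟨ cong (pairs n) ([]≔-++-↑ʳ L R (i ↑ˡ 0)) ⟩
      pairs n (L ++ (R [ i ↑ˡ 0 ]≔ false))       ≡⟨ pairs-++ L (R [ i ↑ˡ 0 ]≔ false) ⟩
      zipHalves L (R [ i ↑ˡ 0 ]≔ false)          ≡⟨ zipHalves-updateʳ L R i false ⟩
      zipHalves L R [ i ]≔ (lookup L i , false)
        ≡⟨ cong₂ (λ P p → P [ i ]≔ clear true p) (sym (pairs-++ L R)) (sym (lookup-pairs-++ L R i)) ⟩
      erase (pairs n (L ++ R)) (i , true)        ∎

  weight-pairs : ∀ S → weight (pairs n S) ≡ ∣ S ∣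
  weight-pairs = by-halves _ λ L R →
    trans (cong weight (pairs-++ L R)) (trans (weight-zipHalves L R) (sym (∣++∣ L R)))

  pairs-∁ : ∀ S → pairs n (∁ S) ≡ map complement (pairs n S)
  pairs-∁ S =
    trans (cong₂ zipHalves (take-map not n S) (drop-map not n S)) (zipHalves-∁ (take n S) (drop n S))

  side : Position n → Fin n ⊎ Fin (n + 0)
  side (i , false) = inj₁ i
  side (i , true)  = inj₂ (i ↑ˡ 0)

  splitAt-element : ∀ q → Fin.splitAt n (element n q) ≡ side q
  splitAt-element (i , false) = splitAt-↑ˡ n i (n + 0)
  splitAt-element (i , true)  = splitAt-↑ʳ n (n + 0) (i ↑ˡ 0)

  side-injective : ∀ {q q′} → side q ≡ side q′ → q ≡ q′
  side-injective {i , false} {j , false} refl = refl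
  side-injective {i , true}  {j , true}  e    = cong (_, true) (↑ˡ-injective 0 i j (inj₂-injective e))
  side-injective {_ , false} {_ , true}  ()
  side-injective {_ , true}  {_ , false} ()

  element-injective : ∀ {q q′ : Position n} → element n q ≡ element n q′ → q ≡ q′
  element-injective {q} {q′} e =
    side-injective (trans (sym (splitAt-element q)) (trans (cong (Fin.splitAt n) e) (splitAt-element q′)))

layer : ℕ → ℕ → Bool → Bool
layer n zero    _ = false
layer n (suc s) b with suc s <? n | suc s ≟ n | suc s ≟ 2 * n
... | yes _ | _     | _     = true
... | no _  | yes _ | _     = b
... | no _  | no _  | yes _ = true
... | no _  | no _  | no _  = false

layer-red⇒positive : ∀ n s b → layer n s b ≡ true → 0 < s
layer-red⇒positive n (suc s) b _ = s≤s z≤n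

layer-red⇒small : ∀ n s b → layer n s b ≡ true → s ≢ 2 * n → s ≤ n
layer-red⇒small n (suc s) b red s≢2n with suc s <? n | suc s ≟ n | suc s ≟ 2 * n
... | yes s<n | _       | _      = <⇒≤ s<n
... | no _    | yes s≡n | _      = ≤-reflexive s≡n
... | no _    | no _    | yes s≡2n = ⊥-elim (s≢2n s≡2n)
layer-red⇒small n (suc s) b () s≢2n | no _ | no _ | no _

layer-blue⇒large : ∀ n s b → layer n s b ≡ false → 0 < s → n ≤ s
layer-blue⇒large n (suc s) b blue _ with suc s <? n | suc s ≟ n | suc s ≟ 2 * n
layer-blue⇒large n (suc s) b () _ | yes _ | _ | _
... | no s≮n | _ | _ = ≮⇒≥ s≮n

layer-top : ∀ k b → layer (suc k) (2 * suc k) b ≡ true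
layer-top k b with 2 * suc k <? suc k | 2 * suc k ≟ suc k | 2 * suc k ≟ 2 * suc k
... | yes _      | _       | _        = refl
... | no _       | yes 2n≡n | _       = ⊥-elim (m+1+n≢m (suc k) 2n≡n)
... | no _       | no _    | yes _    = refl
... | no _       | no _    | no 2n≢2n = ⊥-elim (2n≢2n refl)

layer-middle : ∀ k b → layer (suc k) (suc k) b ≡ b
layer-middle k b with suc k <? suc k | suc k ≟ suc k
... | yes k<k | _      = ⊥-elim (<-irrefl refl k<k)
... | no _    | yes _  = refl
... | no _    | no k≢k = ⊥-elim (k≢k refl)

colour : ∀ n → Subset (2 * n) → Bool
colour n S = layer n ∣ S ∣ (middle false true (pairs n S))

dual-colour : ∀ n → Subset (2 * n) → Bool
dual-colour n S = not (colour n (∁ S))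

module _ (m : ℕ) where

  private
    n : ℕ
    n = 3 + m

  module _ (t β : Bool) (red : Subset (2 * n) → Bool)
           (red≡middle : ∀ R → ∣ R ∣ ≡ n → red R ≡ middle t β (pairs n R))
           {C : Subset (2 * n)} (∣C∣ : ∣ C ∣ ≡ suc n) where

    good-facet : ∀ {q} → Good t β (pairs n C) q → element n q ∈ C × red (remove C (element n q)) ≡ false
    good-facet {q} (q∈ , blue) =
      c∈C , trans (red≡middle (remove C (element n q)) ∣C-c∣)
                  (trans (cong (middle t β) (pairs-remove n C q)) blue)
      where
      c∈C = element-∈ n {C} {q} q∈
      ∣C-c∣ = suc-injective (trans (∣remove∣ C c∈C) ∣C∣)

    blue-facet-via-pairs : ∀ x → ∃ λ c → c ∈ C × c ≢ x × red (remove C c) ≡ false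
    blue-facet-via-pairs x with two-good t β (pairs n C) (trans (weight-pairs n C) ∣C∣)
    ... | q , q′ , q≢q′ , good , good′ with element n q Fin.≟ x
    ...   | no  q≢x = element n q  , proj₁ (good-facet good)  , q≢x  , proj₂ (good-facet good)
    ...   | yes q≡x = element n q′ , proj₁ (good-facet good′) , q′≢x , proj₂ (good-facet good′)
      where
      q′≢x : element n q′ ≢ x
      q′≢x q′≡x = q≢q′ (element-injective n (trans q≡x (sym q′≡x)))

  colour-criterion : RedCriterion n (colour n)
  colour-criterion = record
    { red⇒nonempty = λ S → layer-red⇒positive n ∣ S ∣ _
    ; red⇒small    = λ S red S≢⊤ → layer-red⇒small n ∣ S ∣ _ red (S≢⊤ ∘ ∣p∣≡n⇒p≡⊤)
    ; blue-facet   = λ C x ∣C∣ → blue-facet-via-pairs false true (colour n) colour-middle ∣C∣ x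
    }
    where
    colour-middle : ∀ R → ∣ R ∣ ≡ n → colour n R ≡ middle false true (pairs n R)
    colour-middle R ∣R∣ =
      trans (cong (λ s → layer n s (middle false true (pairs n R))) ∣R∣) (layer-middle (2 + m) _)

  dual-colour-criterion : RedCriterion n (dual-colour n)
  dual-colour-criterion = record
    { red⇒nonempty = red⇒nonempty
    ; red⇒small    = red⇒small
    ; blue-facet   = λ C x ∣C∣ → blue-facet-via-pairs true false (dual-colour n) dual-colour-middle ∣C∣ x
    }
    where
    open ≡-Reasoning

    ∁-blue : ∀ S → dual-colour n S ≡ true → colour n (∁ S) ≡ false
    ∁-blue S red = not-injective red

    red⇒nonempty : ∀ S → dual-colour n S ≡ true → 0 < ∣ S ∣
    red⇒nonempty S red with ∣ S ∣ in ∣S∣≡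
    ... | suc _ = s≤s z≤n
    ... | zero  = ⊥-elim (true≢false (trans (sym ∁S-red) (∁-blue S red)))
      where
      ∁S-red : colour n (∁ S) ≡ true
      ∁S-red = trans (cong (λ s → layer n s (middle false true (pairs n (∁ S))))
                           (trans (∣∁p∣≡n∸∣p∣ S) (cong (2 * n ∸_) ∣S∣≡)))
                     (layer-top (2 + m) _)

    red⇒small : ∀ S → dual-colour n S ≡ true → S ≢ ⊤ → ∣ S ∣ ≤ n
    red⇒small S red S≢⊤ = ≤-trans (+-cancelˡ-≤ n _ _ n+∣S∣≤2n) (≤-reflexive (+-identityʳ n))
      where
      ∣S∣<2n : ∣ S ∣ < 2 * n
      ∣S∣<2n = ≤∧≢⇒< (∣p∣≤n S) (S≢⊤ ∘ ∣p∣≡n⇒p≡⊤)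
      n≤∣∁S∣ : n ≤ 2 * n ∸ ∣ S ∣
      n≤∣∁S∣ = subst (n ≤_) (∣∁p∣≡n∸∣p∣ S) (layer-blue⇒large n _ _ (∁-blue S red)
                 (subst (0 <_) (sym (∣∁p∣≡n∸∣p∣ S)) (m<n⇒0<n∸m ∣S∣<2n)))
      n+∣S∣≤2n : n + ∣ S ∣ ≤ n + (n + 0)
      n+∣S∣≤2n = m≤o∸n⇒m+n≤o n (<⇒≤ ∣S∣<2n) n≤∣∁S∣

    dual-colour-middle : ∀ R → ∣ R ∣ ≡ n → dual-colour n R ≡ middle true false (pairs n R)
    dual-colour-middle R ∣R∣ = begin
      not (layer n ∣ ∁ R ∣ (middle false true (pairs n (∁ R))))
        ≡⟨ cong (λ s → not (layer n s (middle false true (pairs n (∁ R))))) ∣∁R∣ ⟩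
      not (layer n n (middle false true (pairs n (∁ R))))   ≡⟨ cong not (layer-middle (2 + m) _) ⟩
      not (middle false true (pairs n (∁ R)))
        ≡⟨ cong (not ∘ middle false true) (pairs-∁ n R) ⟩
      not (middle false true (map complement (pairs n R)))
        ≡⟨ cong not (middle-complement false true (pairs n R)) ⟩
      not (middle true true (pairs n R))                    ≡⟨ sym (middle-not true true (pairs n R)) ⟩
      middle true false (pairs n R)                         ∎
      where
      ∣∁R∣ : ∣ ∁ R ∣ ≡ n
      ∣∁R∣ = trans (∣∁p∣≡n∸∣p∣ R) (trans (cong (2 * n ∸_) ∣R∣) (trans (m+n∸m≡n n (n + 0)) (+-identityʳ n)))

theorem1 : (n : ℕ) → 3 ≤ n →
    Σ (Coloring (2 * n)) λ c →
      (f : Subset n → Subset (2 * n)) → IsCubeEmbedding f → ¬ Monochromatic c f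
theorem1 (suc (suc (suc m))) (s≤s (s≤s (s≤s z≤n))) = colour n , no-monochromatic-copy
  where
  n = 3 + m
  no-monochromatic-copy : (f : Subset n → Subset (2 * n)) → IsCubeEmbedding f → ¬ Monochromatic (colour n) f
  no-monochromatic-copy f emb (true  , red)  =
    no-red-cube (colour-criterion m) (IsCubeEmbedding.order emb) red
  no-monochromatic-copy f emb (false , blue) =
    no-red-cube (dual-colour-criterion m) (∁-conjugate (IsCubeEmbedding.order emb))
      λ S → cong not (trans (cong (colour n) (∁-involutive (f (∁ S)))) (blue (∁ S)))
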